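{- For every graph $G$, $\gamma_{WC}(G)=\frac{v(G)-v(R(G))}{2}+\gamma_{WC}(R(G))$ and $s_{WC}(G)=\frac{v(G)-v(R(G))}{2}+s_{WC}(R(G))$.
   Context: $v(G)$ is the number of vertices of $G$. The residue $R(G)$ is obtained from $G$ by iteratively deleting, as long as possible, two adjacent vertices $v,w$ such that $v$ is a leaf in the current graph and $w$ is its neighbour of degree $2$ in the current graph; the resulting graph does not depend on the order of deletions. The Waiter-Client domination game on a graph: in each round Dominator offers two unclaimed vertices, Staller takes one and the other goes to Dominator (a single last remaining vertex goes to Staller); Dominator wins if she claims a dominating set. $\gamma_{WC}(G)$ is the smallest number of rounds within which Dominator can always occupy a dominating set, and $s_{WC}(G)$ the smallest size of a dominating set she can always claim (both $\infty$ if she cannot win). -}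

module Defs where

open import Data.Nat using (ℕ; zero; suc; _+_; _≤_; ⌊_/2⌋; _∸_)
open import Data.Bool using (Bool; true; false)
open import Data.Fin using (Fin; punchIn)
open import Data.Fin.Subset using (Subset; _∈_; _∉_; _∪_; _-_; ⁅_⁆; ∣_∣; _⊆_; ⊥; ⊤)
open import Data.Vec using (tabulate)
open import Data.Maybe using (Maybe; just; nothing)
open import Data.Product using (Σ; ∃; _×_; _,_)
open import Data.Sum using (_⊎_)
open import Relation.Nullary using (¬_)
open import Relation.Binary.PropositionalEquality using (_≡_; _≢_)

record Graph (n : ℕ) : Set where
  field
    adj    : Fin n → Fin n → Bool
    sym    : ∀ u v → adj u v ≡ adj v u
    irrefl : ∀ v → adj v v ≡ false
open Graph public

-- v(G) is the index n of G : Graph n.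

deg : ∀ {n} → Graph n → Fin n → ℕ
deg G v = ∣ tabulate (adj G v) ∣

removeVertex : ∀ {n} → Graph (suc n) → Fin (suc n) → Graph n
removeVertex G i = record
  { adj    = λ a b → adj G (punchIn i a) (punchIn i b)
  ; sym    = λ a b → sym G (punchIn i a) (punchIn i b)
  ; irrefl = λ a → irrefl G (punchIn i a)
  }

-- One reduction step: delete a leaf v together with its neighbour w,
-- where w has degree 2.  (w is given as w' : Fin (suc n), the index of w
-- in G - v; w = punchIn v w' in G.)
data Step : ∀ {m n} → Graph m → Graph n → Set where
  step : ∀ {n} (G : Graph (suc (suc n))) (v : Fin (suc (suc n))) (w' : Fin (suc n)) →
         adj G v (punchIn v w') ≡ true →
         deg G v ≡ 1 →
         deg G (punchIn v w') ≡ 2 →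
         Step G (removeVertex (removeVertex G v) w')

Irreducible : ∀ {m} → Graph m → Set
Irreducible G = ∀ {n} (H : Graph n) → ¬ Step G H

data Residue : ∀ {m n} → Graph m → Graph n → Set where
  done : ∀ {m} {G : Graph m} → Irreducible G → Residue G G
  more : ∀ {k m n} {G : Graph k} {G' : Graph m} {H : Graph n} →
         Step G G' → Residue G' H → Residue G H

Dominating : ∀ {n} → Graph n → Subset n → Set
Dominating G D = ∀ v → v ∈ D ⊎ ∃ λ u → u ∈ D × adj G v u ≡ true

-- State: U = unclaimed vertices, D = Dominator's vertices.
-- In a round Dominator offers distinct unclaimed u, w; Staller takes one,
-- Dominator gets the other.  (A single last vertex goes to Staller, which
-- never helps Dominator, so it needs no rule.)

data WinWithin {n} (G : Graph n) : ℕ → Subset n → Subset n → Set where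
  won   : ∀ {k U D} → Dominating G D → WinWithin G k U D
  round : ∀ {k U D} (u w : Fin n) → u ∈ U → w ∈ U → u ≢ w →
          WinWithin G k ((U - u) - w) (D ∪ ⁅ w ⁆) →
          WinWithin G k ((U - u) - w) (D ∪ ⁅ u ⁆) →
          WinWithin G (suc k) U D

data WinSize {n} (G : Graph n) (s : ℕ) : Subset n → Subset n → Set where
  won   : ∀ {U D} (S : Subset n) → S ⊆ D → Dominating G S → ∣ S ∣ ≤ s →
          WinSize G s U D
  round : ∀ {U D} (u w : Fin n) → u ∈ U → w ∈ U → u ≢ w →
          WinSize G s ((U - u) - w) (D ∪ ⁅ w ⁆) →
          WinSize G s ((U - u) - w) (D ∪ ⁅ u ⁆) →
          WinSize G s U D

-- ℕ ∪ {∞} as Maybe ℕ (nothing = ∞) and "x is the least k with P k"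

ℕ∞ : Set
ℕ∞ = Maybe ℕ

_⊕_ : ℕ → ℕ∞ → ℕ∞
d ⊕ just k  = just (d + k)
d ⊕ nothing = nothing

IsMin : (ℕ → Set) → ℕ∞ → Set
IsMin P (just k) = P k × (∀ j → P j → k ≤ j)
IsMin P nothing  = ∀ j → ¬ P j

Isγ : ∀ {n} → Graph n → ℕ∞ → Set
Isγ G = IsMin (λ k → WinWithin G k ⊤ ⊥)

IsS : ∀ {n} → Graph n → ℕ∞ → Set
IsS G = IsMin (λ s → WinSize G s ⊤ ⊥)

-- Let v be a leaf of G with neighbour w. To dominate v, Dominator must claim v
-- or w. If she ever offers one of them together with a third vertex, Staller
-- takes it and later takes the other one too, so Dominator has to offer {v, w}
-- as a pair; Staller then takes w, and Dominator's v dominates nothing outside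
-- {v, w}, so the remaining play is a play on G − v − w. Conversely, opening with
-- {v, w} and then following a winning strategy on G − v − w wins on G. Hence
-- deleting v and w lowers both γ_WC and s_WC by exactly one, and the corollary
-- follows by induction along the reduction sequence.

module Submission where

open import Defs hiding (sym)
open import Data.Nat using (ℕ; zero; suc; _+_; _∸_; ⌊_/2⌋; _≤_; _⊔_; z≤n; s≤s)
open import Data.Nat.Properties
  using (≤-refl; ≤-reflexive; ≤-trans; ≤-antisym; ≤-pred; m≤n+m; m≤m⊔n; m≤n⊔m; +-assoc; n∸n≡0; +-∸-assoc;
         module ≤-Reasoning)
open import Data.Bool using (true)
open import Data.Fin using (Fin; zero; suc; punchIn; punchOut; _≟_)
open import Data.Fin.Properties using (punchIn-injective; punchInᵢ≢i; punchIn-punchOut)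
open import Data.Fin.Subset
  using (Subset; Side; inside; outside; _∈_; _∉_; _∪_; _─_; _-_; ⁅_⁆; ∣_∣; _⊆_; ⊥; ⊤)
open import Data.Fin.Subset.Properties
  using (x∈⁅x⁆; x∈⁅y⁆⇒x≡y; ∈⊤; ∉⊥; p⊆p∪q; q⊆p∪q; x∈p∪q⁻; p─q⊆p; x∈p∧x≢y⇒x∈p-y;
         x∈p⇒∣p-x∣<∣p∣; ∣p∣≤∣x∷p∣)
open import Data.Vec using (Vec; _∷_; here; there; lookup; tabulate; insertAt; removeAt)
open import Data.Vec.Properties
  using ([]=⇒lookup; lookup⇒[]=; lookup∘tabulate; insertAt-lookup; insertAt-punchIn; insertAt-removeAt)
open import Data.Maybe using (just; nothing)
open import Data.Product using (∃; _×_; _,_)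
open import Data.Sum using (_⊎_; inj₁; inj₂; [_,_])
import Data.Sum as Sum
open import Data.Empty using (⊥-elim)
open import Function using (_∘_)
open import Function.Bundles using (_⇔_; mk⇔; Equivalence)
import Function.Properties.Equivalence as ⇔
open import Relation.Nullary using (¬_; yes; no; contradiction)
open import Relation.Binary.PropositionalEquality
  using (_≡_; _≢_; refl; sym; trans; cong; subst; module ≡-Reasoning)

open Equivalence using (to; from)

x∈p─q⇒x∉q : ∀ {n} {x : Fin n} (p q : Subset n) → x ∈ p ─ q → x ∉ q
x∈p─q⇒x∉q (_ ∷ p) (outside ∷ q) here ()
x∈p─q⇒x∉q (_ ∷ p) (_ ∷ q) (there x∈p─q) (there x∈q) = x∈p─q⇒x∉q p q x∈p─q x∈q

module _ {n : ℕ} where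

  x∈p-y⇒x≢y : ∀ {x y : Fin n} {p : Subset n} → x ∈ p - y → x ≢ y
  x∈p-y⇒x≢y {y = y} {p} x∈p-y refl = x∈p─q⇒x∉q p ⁅ y ⁆ x∈p-y (x∈⁅x⁆ y)

  x∉p-x : ∀ {x : Fin n} {p : Subset n} → x ∉ p - x
  x∉p-x x∈p-x = x∈p-y⇒x≢y x∈p-x refl

  x∉p⇒x∉p-y : ∀ {x y : Fin n} {p : Subset n} → x ∉ p → x ∉ p - y
  x∉p⇒x∉p-y {y = y} {p} x∉p = x∉p ∘ p─q⊆p p ⁅ y ⁆

  x∉p⇒x∉p-y-z : ∀ {x y z : Fin n} {p : Subset n} → x ∉ p → x ∉ p - y - z
  x∉p⇒x∉p-y-z = x∉p⇒x∉p-y ∘ x∉p⇒x∉p-y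

  x∈p∪⁅x⁆ : ∀ {x : Fin n} {p : Subset n} → x ∈ p ∪ ⁅ x ⁆
  x∈p∪⁅x⁆ {x} {p} = q⊆p∪q p ⁅ x ⁆ (x∈⁅x⁆ x)

  x∈p∪⁅y⁆⁻ : ∀ {x y : Fin n} {p : Subset n} → x ∈ p ∪ ⁅ y ⁆ → x ∈ p ⊎ x ≡ y
  x∈p∪⁅y⁆⁻ {y = y} {p} = Sum.map₂ (x∈⁅y⁆⇒x≡y y) ∘ x∈p∪q⁻ p ⁅ y ⁆

  x∉p∪⁅y⁆ : ∀ {x y : Fin n} {p : Subset n} → x ∉ p → x ≢ y → x ∉ p ∪ ⁅ y ⁆
  x∉p∪⁅y⁆ x∉p x≢y = [ x∉p , x≢y ] ∘ x∈p∪⁅y⁆⁻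

  lookup⇒∈⇔∈ : ∀ {m} {x : Fin n} {y : Fin m} {p q} →
               lookup p x ≡ lookup q y → x ∈ p ⇔ y ∈ q
  lookup⇒∈⇔∈ {x = x} {y} {p} {q} eq = mk⇔
    (λ x∈p → lookup⇒[]= y q (trans (sym eq) ([]=⇒lookup x∈p)))
    (λ y∈q → lookup⇒[]= x p (trans eq ([]=⇒lookup y∈q)))

  ∈-tabulate : ∀ (f : Fin n → Side) {x} → f x ≡ inside → x ∈ tabulate f
  ∈-tabulate f {x} fx = lookup⇒[]= x (tabulate f) (trans (lookup∘tabulate f x) fx)

  two-elements⇒2≤∣p∣ : ∀ {x y : Fin n} {p : Subset n} → x ∈ p → y ∈ p → x ≢ y → 2 ≤ ∣ p ∣
  two-elements⇒2≤∣p∣ x∈p y∈p x≢y =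
    ≤-trans (s≤s (≤-trans (s≤s z≤n) (x∈p⇒∣p-x∣<∣p∣ (x∈p∧x≢y⇒x∈p-y x∈p x≢y))))
            (x∈p⇒∣p-x∣<∣p∣ y∈p)

∣insertAt∣ : ∀ {n} (p : Subset n) i x → ∣ insertAt p i x ∣ ≡ ∣ x ∷ p ∣
∣insertAt∣ p             zero    x       = refl
∣insertAt∣ (outside ∷ p) (suc i) x       = ∣insertAt∣ p i x
∣insertAt∣ (inside ∷ p)  (suc i) inside  = cong suc (∣insertAt∣ p i inside)
∣insertAt∣ (inside ∷ p)  (suc i) outside = cong suc (∣insertAt∣ p i outside)

∣removeAt∣ : ∀ {n} (p : Subset (suc n)) i → ∣ p ∣ ≡ ∣ lookup p i ∷ removeAt p i ∣
∣removeAt∣ p i = trans (cong ∣_∣ (sym (insertAt-removeAt p i))) (∣insertAt∣ (removeAt p i) i (lookup p i))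

lookup-removeAt : ∀ {n} {A : Set} (xs : Vec A (suc n)) i j →
                  lookup (removeAt xs i) j ≡ lookup xs (punchIn i j)
lookup-removeAt xs i j = begin
  lookup (removeAt xs i) j
    ≡⟨ insertAt-punchIn (removeAt xs i) i (lookup xs i) j ⟨
  lookup (insertAt (removeAt xs i) i (lookup xs i)) (punchIn i j)
    ≡⟨ cong (λ ys → lookup ys (punchIn i j)) (insertAt-removeAt xs i) ⟩
  lookup xs (punchIn i j)
    ∎
  where open ≡-Reasoning

-- WinWithin with Dominating G replaced by an arbitrary goal P; WinSize is the
-- version of Forces (HasDominatingSubset G s) without a bound on the rounds.
data Forces {n} (P : Subset n → Set) : ℕ → Subset n → Subset n → Set where
  won   : ∀ {k U D} → P D → Forces P k U D
  round : ∀ {k U D} (a b : Fin n) → a ∈ U → b ∈ U → a ≢ b →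
          Forces P k (U - a - b) (D ∪ ⁅ b ⁆) →
          Forces P k (U - a - b) (D ∪ ⁅ a ⁆) →
          Forces P (suc k) U D

Forces-mono : ∀ {n} {P : Subset n → Set} {k l U D} → k ≤ l → Forces P k U D → Forces P l U D
Forces-mono _         (won p)                       = won p
Forces-mono (s≤s k≤l) (round a b a∈U b∈U a≢b f g) =
  round a b a∈U b∈U a≢b (Forces-mono k≤l f) (Forces-mono k≤l g)

HasDominatingSubset : ∀ {n} → Graph n → ℕ → Subset n → Set
HasDominatingSubset G s D = ∃ λ S → S ⊆ D × Dominating G S × ∣ S ∣ ≤ s

module _ {n} {G : Graph n} where

  WinWithin⇔Forces : ∀ {k U D} → WinWithin G k U D ⇔ Forces (Dominating G) k U D
  WinWithin⇔Forces = mk⇔ toForces fromForces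
    where
    toForces : ∀ {k U D} → WinWithin G k U D → Forces (Dominating G) k U D
    toForces (won d)                    = won d
    toForces (round a b a∈U b∈U a≢b f g) = round a b a∈U b∈U a≢b (toForces f) (toForces g)
    fromForces : ∀ {k U D} → Forces (Dominating G) k U D → WinWithin G k U D
    fromForces (won d)                    = won d
    fromForces (round a b a∈U b∈U a≢b f g) = round a b a∈U b∈U a≢b (fromForces f) (fromForces g)

  WinSize⇔Forces : ∀ {s U D} → WinSize G s U D ⇔ ∃ λ k → Forces (HasDominatingSubset G s) k U D
  WinSize⇔Forces {s} = mk⇔ toForces (λ (_ , f) → fromForces f)
    where
    toForces : ∀ {U D} → WinSize G s U D → ∃ λ k → Forces (HasDominatingSubset G s) k U D
    toForces (won S S⊆D dom size) = 0 , won (S , S⊆D , dom , size)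
    toForces (round a b a∈U b∈U a≢b f g) with toForces f | toForces g
    ... | k , f′ | l , g′ =
      suc (k ⊔ l) , round a b a∈U b∈U a≢b (Forces-mono (m≤m⊔n k l) f′) (Forces-mono (m≤n⊔m k l) g′)
    fromForces : ∀ {k U D} → Forces (HasDominatingSubset G s) k U D → WinSize G s U D
    fromForces (won (S , S⊆D , dom , size))  = won S S⊆D dom size
    fromForces (round a b a∈U b∈U a≢b f g) = round a b a∈U b∈U a≢b (fromForces f) (fromForces g)

module VertexPair {n} (v : Fin (suc (suc n))) (w′ : Fin (suc n)) where

  w : Fin (suc (suc n))
  w = punchIn v w′

  emb : Fin n → Fin (suc (suc n))
  emb j = punchIn v (punchIn w′ j)

  v≢w : v ≢ w
  v≢w v≡w = punchInᵢ≢i v w′ (sym v≡w)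

  emb≢v : ∀ j → emb j ≢ v
  emb≢v j = punchInᵢ≢i v _

  emb≢w : ∀ j → emb j ≢ w
  emb≢w j = punchInᵢ≢i w′ j ∘ punchIn-injective v _ _

  emb-injective : ∀ {i j} → emb i ≡ emb j → i ≡ j
  emb-injective = punchIn-injective w′ _ _ ∘ punchIn-injective v _ _

  data Position : Fin (suc (suc n)) → Set where
    at-v   : Position v
    at-w   : Position w
    at-emb : ∀ j → Position (emb j)

  position : ∀ z → Position z
  position z with v ≟ z
  ... | yes refl = at-v
  ... | no v≢z with w′ ≟ punchOut v≢z
  ... | yes w′≡ = subst Position (trans (cong (punchIn v) w′≡) (punchIn-punchOut v≢z)) at-w
  ... | no w′≢ = subst Position
                   (trans (cong (punchIn v) (punchIn-punchOut w′≢)) (punchIn-punchOut v≢z))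
                   (at-emb (punchOut w′≢))

  Trace : Subset (suc (suc n)) → Subset n → Set
  Trace X X′ = ∀ j → emb j ∈ X ⇔ j ∈ X′

  Outside : Fin (suc (suc n)) → Set
  Outside y = ∀ j → emb j ≢ y

  trace-⊤ : Trace ⊤ ⊤
  trace-⊤ j = mk⇔ (λ _ → ∈⊤) (λ _ → ∈⊤)

  trace-⊥ : Trace ⊥ ⊥
  trace-⊥ j = mk⇔ (⊥-elim ∘ ∉⊥) (⊥-elim ∘ ∉⊥)

  trace-minus : ∀ {X X′} a → Trace X X′ → Trace (X - emb a) (X′ - a)
  trace-minus a t j = mk⇔
    (λ e∈ → x∈p∧x≢y⇒x∈p-y (to (t j) (p─q⊆p _ _ e∈)) (x∈p-y⇒x≢y e∈ ∘ cong emb))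
    (λ j∈ → x∈p∧x≢y⇒x∈p-y (from (t j) (p─q⊆p _ _ j∈)) (x∈p-y⇒x≢y j∈ ∘ emb-injective))

  trace-add : ∀ {X X′} a → Trace X X′ → Trace (X ∪ ⁅ emb a ⁆) (X′ ∪ ⁅ a ⁆)
  trace-add a t j = mk⇔
    ([ p⊆p∪q _ ∘ to (t j) , (λ e≡ → subst (_∈ _) (sym (emb-injective e≡)) x∈p∪⁅x⁆) ] ∘ x∈p∪⁅y⁆⁻)
    ([ p⊆p∪q _ ∘ from (t j) , (λ j≡ → subst (λ i → emb i ∈ _) (sym j≡) x∈p∪⁅x⁆) ] ∘ x∈p∪⁅y⁆⁻)

  trace-minus-outside : ∀ {X X′ y} → Outside y → Trace X X′ → Trace (X - y) X′
  trace-minus-outside out t j = mk⇔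
    (to (t j) ∘ p─q⊆p _ _) (λ j∈ → x∈p∧x≢y⇒x∈p-y (from (t j) j∈) (out j))

  trace-add-outside : ∀ {X X′ y} → Outside y → Trace X X′ → Trace (X ∪ ⁅ y ⁆) X′
  trace-add-outside out t j = mk⇔
    ([ to (t j) , ⊥-elim ∘ out j ] ∘ x∈p∪⁅y⁆⁻) (p⊆p∪q _ ∘ from (t j))

  shrink : Subset (suc (suc n)) → Subset n
  shrink S = removeAt (removeAt S v) w′

  trace-shrink : ∀ S → Trace S (shrink S)
  trace-shrink S j = lookup⇒∈⇔∈ (sym (begin
    lookup (shrink S) j                    ≡⟨ lookup-removeAt (removeAt S v) w′ j ⟩
    lookup (removeAt S v) (punchIn w′ j)   ≡⟨ lookup-removeAt S v (punchIn w′ j) ⟩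
    lookup S (emb j)                       ∎))
    where open ≡-Reasoning

  ∣shrink∣ : ∀ {S} → v ∈ S → suc ∣ shrink S ∣ ≤ ∣ S ∣
  ∣shrink∣ {S} v∈S = begin
    suc ∣ shrink S ∣                              ≤⟨ s≤s (∣p∣≤∣x∷p∣ (lookup (removeAt S v) w′) (shrink S)) ⟩
    suc ∣ lookup (removeAt S v) w′ ∷ shrink S ∣   ≡⟨ cong suc (∣removeAt∣ (removeAt S v) w′) ⟨
    suc ∣ removeAt S v ∣                          ≡⟨ cong (λ x → ∣ x ∷ removeAt S v ∣) ([]=⇒lookup v∈S) ⟨
    ∣ lookup S v ∷ removeAt S v ∣                 ≡⟨ ∣removeAt∣ S v ⟨
    ∣ S ∣                                         ∎
    where open ≤-Reasoning

  extend : Subset n → Side → Side → Subset (suc (suc n))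
  extend S′ x y = insertAt (insertAt S′ w′ y) v x

  trace-extend : ∀ S′ x y → Trace (extend S′ x y) S′
  trace-extend S′ x y j =
    lookup⇒∈⇔∈ (trans (insertAt-punchIn _ v x (punchIn w′ j)) (insertAt-punchIn S′ w′ y j))

  lookup-extend-v : ∀ S′ x y → lookup (extend S′ x y) v ≡ x
  lookup-extend-v S′ x y = insertAt-lookup _ v x

  lookup-extend-w : ∀ S′ x y → lookup (extend S′ x y) w ≡ y
  lookup-extend-w S′ x y = trans (insertAt-punchIn _ v x w′) (insertAt-lookup S′ w′ y)

  ∣extend∣ : ∀ S′ x y → ∣ extend S′ x y ∣ ≡ ∣ x ∷ y ∷ S′ ∣
  ∣extend∣ S′ inside  y = trans (∣insertAt∣ _ v inside) (cong suc (∣insertAt∣ S′ w′ y))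
  ∣extend∣ S′ outside y = trans (∣insertAt∣ _ v outside) (∣insertAt∣ S′ w′ y)

  ∉-claim : ∀ {x D} c → Outside x → x ∉ D → x ∉ D ∪ ⁅ emb c ⁆
  ∉-claim c x-out x∉D = x∉p∪⁅y⁆ x∉D (x-out c ∘ sym)

  ∈-round : ∀ {x U} a b → Outside x → x ∈ U → x ∈ U - emb a - emb b
  ∈-round a b x-out x∈U = x∈p∧x≢y⇒x∈p-y (x∈p∧x≢y⇒x∈p-y x∈U (x-out a ∘ sym)) (x-out b ∘ sym)

  record Mirrors (U D : Subset (suc (suc n))) (U′ D′ : Subset n) : Set where
    field
      unclaimed : Trace U U′
      claimed   : Trace D D′
  open Mirrors

  mirrors-start : Mirrors ⊤ ⊥ ⊤ ⊥
  mirrors-start = record { unclaimed = trace-⊤ ; claimed = trace-⊥ }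

  mirror-round : ∀ {U D U′ D′} a b c → Mirrors U D U′ D′ →
                 Mirrors (U - emb a - emb b) (D ∪ ⁅ emb c ⁆) (U′ - a - b) (D′ ∪ ⁅ c ⁆)
  mirror-round a b c m = record
    { unclaimed = trace-minus b (trace-minus a (unclaimed m))
    ; claimed   = trace-add c (claimed m)
    }

  outside-round : ∀ {U D U′ D′ a b c} → Outside a → Outside b → Outside c → Mirrors U D U′ D′ →
                  Mirrors (U - a - b) (D ∪ ⁅ c ⁆) U′ D′
  outside-round a-out b-out c-out m = record
    { unclaimed = trace-minus-outside b-out (trace-minus-outside a-out (unclaimed m))
    ; claimed   = trace-add-outside c-out (claimed m)
    }

  emb-covers : ∀ {U z} → v ∉ U → w ∉ U → z ∈ U → ∃ λ j → emb j ≡ z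
  emb-covers {z = z} v∉U w∉U z∈U with position z
  ... | at-v     = contradiction z∈U v∉U
  ... | at-w     = contradiction z∈U w∉U
  ... | at-emb j = j , refl

  -- A winning condition that forces Dominator to claim v or w turns play on
  -- Fin (2 + n) into play on Fin n with one round less.
  module Transfer {P : Subset (suc (suc n)) → Set} {P′ : Subset n → Set}
    (claims        : ∀ {D} → P D → v ∈ D ⊎ w ∈ D)
    (restrict-goal : ∀ {D D′} → Trace D D′ → w ∉ D → P D → P′ D′)
    (lift-goal     : ∀ {D D′} → Trace D D′ → v ∈ D ⊎ w ∈ D → P′ D′ → P D)
    where

    -- Staller's strategy: take v or w whenever it is offered.
    unwinnable : ∀ {k U D} → v ∉ D → w ∉ D → v ∉ U ⊎ w ∉ U → ¬ Forces P k U D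
    unwinnable v∉D w∉D _ (won p) = [ v∉D , w∉D ] (claims p)
    unwinnable {U = U} v∉D w∉D vw∉U (round a b a∈U b∈U a≢b f g) with position b
    ... | at-v = unwinnable (x∉p∪⁅y⁆ v∉D (a≢b ∘ sym)) (x∉p∪⁅y⁆ w∉D w≢a) (inj₁ x∉p-x) g
      where
      w≢a : w ≢ a
      w≢a w≡a = [ contradiction b∈U , contradiction (subst (_∈ U) (sym w≡a) a∈U) ] vw∉U
    ... | at-w = unwinnable (x∉p∪⁅y⁆ v∉D v≢a) (x∉p∪⁅y⁆ w∉D (a≢b ∘ sym)) (inj₂ x∉p-x) g
      where
      v≢a : v ≢ a
      v≢a v≡a = [ contradiction (subst (_∈ U) (sym v≡a) a∈U) , contradiction b∈U ] vw∉U
    ... | at-emb j =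
      unwinnable (∉-claim j emb≢v v∉D) (∉-claim j emb≢w w∉D) (Sum.map x∉p⇒x∉p-y-z x∉p⇒x∉p-y-z vw∉U) f

    unwon-at-zero : ∀ {U D} → v ∉ D → w ∉ D → ¬ Forces P 0 U D
    unwon-at-zero v∉D w∉D (won p) = [ v∉D , w∉D ] (claims p)

    restrict-claimed : ∀ {k U D U′ D′} → Mirrors U D U′ D′ → v ∉ U → w ∉ U → w ∉ D →
                       Forces P k U D → Forces P′ k U′ D′
    restrict-claimed m _ _ w∉D (won p) = won (restrict-goal (claimed m) w∉D p)
    restrict-claimed m v∉U w∉U w∉D (round a b a∈U b∈U a≢b f g)
      with emb-covers v∉U w∉U a∈U | emb-covers v∉U w∉U b∈U
    ... | a′ , refl | b′ , refl =
      round a′ b′ (to (unclaimed m a′) a∈U) (to (unclaimed m b′) b∈U) (a≢b ∘ cong emb)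
        (restrict-claimed (mirror-round a′ b′ b′ m) (x∉p⇒x∉p-y-z v∉U) (x∉p⇒x∉p-y-z w∉U)
                          (∉-claim b′ emb≢w w∉D) f)
        (restrict-claimed (mirror-round a′ b′ a′ m) (x∉p⇒x∉p-y-z v∉U) (x∉p⇒x∉p-y-z w∉U)
                          (∉-claim a′ emb≢w w∉D) g)

    -- Staller answers the offer {v, w} by taking w.
    restrict-unclaimed : ∀ {k U D U′ D′} → Mirrors U D U′ D′ → v ∈ U → w ∈ U → v ∉ D → w ∉ D →
                         Forces P (suc k) U D → Forces P′ k U′ D′
    restrict-unclaimed m _ _ v∉D w∉D (won p) = ⊥-elim ([ v∉D , w∉D ] (claims p))
    restrict-unclaimed {k} m v∈U w∈U v∉D w∉D (round a b a∈U b∈U a≢b f g) with position a | position b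
    ... | at-v | at-v = ⊥-elim (a≢b refl)
    ... | at-w | at-w = ⊥-elim (a≢b refl)
    ... | at-v | at-w =
      restrict-claimed (outside-round emb≢v emb≢w emb≢v m) (x∉p⇒x∉p-y x∉p-x) x∉p-x
                       (x∉p∪⁅y⁆ w∉D (v≢w ∘ sym)) g
    ... | at-w | at-v =
      restrict-claimed (outside-round emb≢w emb≢v emb≢v m) x∉p-x (x∉p⇒x∉p-y x∉p-x)
                       (x∉p∪⁅y⁆ w∉D (v≢w ∘ sym)) f
    ... | at-v | at-emb b′ =
      ⊥-elim (unwinnable (∉-claim b′ emb≢v v∉D) (∉-claim b′ emb≢w w∉D) (inj₁ (x∉p⇒x∉p-y x∉p-x)) f)
    ... | at-w | at-emb b′ =
      ⊥-elim (unwinnable (∉-claim b′ emb≢v v∉D) (∉-claim b′ emb≢w w∉D) (inj₂ (x∉p⇒x∉p-y x∉p-x)) f)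
    ... | at-emb a′ | at-v =
      ⊥-elim (unwinnable (∉-claim a′ emb≢v v∉D) (∉-claim a′ emb≢w w∉D) (inj₁ x∉p-x) g)
    ... | at-emb a′ | at-w =
      ⊥-elim (unwinnable (∉-claim a′ emb≢v v∉D) (∉-claim a′ emb≢w w∉D) (inj₂ x∉p-x) g)
    ... | at-emb a′ | at-emb b′ with k
    ...   | zero = ⊥-elim (unwon-at-zero (∉-claim b′ emb≢v v∉D) (∉-claim b′ emb≢w w∉D) f)
    ...   | suc _ =
      round a′ b′ (to (unclaimed m a′) a∈U) (to (unclaimed m b′) b∈U) (a≢b ∘ cong emb)
        (restrict-unclaimed (mirror-round a′ b′ b′ m) (∈-round a′ b′ emb≢v v∈U) (∈-round a′ b′ emb≢w w∈U)
                            (∉-claim b′ emb≢v v∉D) (∉-claim b′ emb≢w w∉D) f)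
        (restrict-unclaimed (mirror-round a′ b′ a′ m) (∈-round a′ b′ emb≢v v∈U) (∈-round a′ b′ emb≢w w∈U)
                            (∉-claim a′ emb≢v v∉D) (∉-claim a′ emb≢w w∉D) g)

    lift : ∀ {k U D U′ D′} → Mirrors U D U′ D′ → v ∉ U → w ∉ U → v ∈ D ⊎ w ∈ D →
           Forces P′ k U′ D′ → Forces P k U D
    lift m _ _ vw∈D (won p′) = won (lift-goal (claimed m) vw∈D p′)
    lift m v∉U w∉U vw∈D (round a′ b′ a′∈U′ b′∈U′ a′≢b′ f g) =
      round (emb a′) (emb b′) (from (unclaimed m a′) a′∈U′) (from (unclaimed m b′) b′∈U′)
            (a′≢b′ ∘ emb-injective)
        (lift (mirror-round a′ b′ b′ m) (x∉p⇒x∉p-y-z v∉U) (x∉p⇒x∉p-y-z w∉U)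
              (Sum.map (p⊆p∪q _) (p⊆p∪q _) vw∈D) f)
        (lift (mirror-round a′ b′ a′ m) (x∉p⇒x∉p-y-z v∉U) (x∉p⇒x∉p-y-z w∉U)
              (Sum.map (p⊆p∪q _) (p⊆p∪q _) vw∈D) g)

    ¬Forces-zero : ¬ Forces P 0 ⊤ ⊥
    ¬Forces-zero = unwon-at-zero ∉⊥ ∉⊥

    Forces-suc⇔ : ∀ {k} → Forces P (suc k) ⊤ ⊥ ⇔ Forces P′ k ⊤ ⊥
    Forces-suc⇔ = mk⇔ (restrict-unclaimed mirrors-start ∈⊤ ∈⊤ ∉⊥ ∉⊥) open-with-v-w
      where
      opening : ∀ x → Outside x → Mirrors (⊤ - v - w) (⊥ ∪ ⁅ x ⁆) ⊤ ⊥
      opening x x-out = outside-round emb≢v emb≢w x-out mirrors-start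
      open-with-v-w : ∀ {k} → Forces P′ k ⊤ ⊥ → Forces P (suc k) ⊤ ⊥
      open-with-v-w f = round v w ∈⊤ ∈⊤ v≢w
        (lift (opening w emb≢w) (x∉p⇒x∉p-y x∉p-x) x∉p-x (inj₂ x∈p∪⁅x⁆) f)
        (lift (opening v emb≢v) (x∉p⇒x∉p-y x∉p-x) x∉p-x (inj₁ x∈p∪⁅x⁆) f)

module LeafRemoval {n} (G : Graph (suc (suc n))) (v : Fin (suc (suc n))) (w′ : Fin (suc n))
  (v~w : adj G v (punchIn v w′) ≡ true) (deg-v : deg G v ≡ 1) where

  open VertexPair v w′

  G′ : Graph n
  G′ = removeVertex (removeVertex G v) w′

  neighbour-of-v : ∀ {u} → adj G v u ≡ true → u ≡ w
  neighbour-of-v {u} v~u with u ≟ w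
  ... | yes u≡w = u≡w
  ... | no u≢w  = contradiction (subst (2 ≤_) deg-v two-neighbours) λ { (s≤s ()) }
    where
    two-neighbours : 2 ≤ deg G v
    two-neighbours = two-elements⇒2≤∣p∣ (∈-tabulate (adj G v) v~u) (∈-tabulate (adj G v) v~w) u≢w

  dominating-claims : ∀ {D} → Dominating G D → v ∈ D ⊎ w ∈ D
  dominating-claims dom with dom v
  ... | inj₁ v∈D             = inj₁ v∈D
  ... | inj₂ (u , u∈D , v~u) = inj₂ (subst (_∈ _) (neighbour-of-v v~u) u∈D)

  dominating-restrict : ∀ {D D′} → Trace D D′ → w ∉ D → Dominating G D → Dominating G′ D′
  dominating-restrict t w∉D dom j with dom (emb j)
  ... | inj₁ j∈D = inj₁ (to (t j) j∈D)
  ... | inj₂ (u , u∈D , j~u) with position u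
  ...   | at-v      = contradiction (neighbour-of-v (trans (Graph.sym G v (emb j)) j~u)) (emb≢w j)
  ...   | at-w      = contradiction u∈D w∉D
  ...   | at-emb u′ = inj₂ (u′ , to (t u′) u∈D , j~u)

  dominating-lift : ∀ {D D′} → Trace D D′ → v ∈ D ⊎ w ∈ D → Dominating G′ D′ → Dominating G D
  dominating-lift t vw∈D dom′ z with position z | vw∈D
  ... | at-v | inj₁ v∈D = inj₁ v∈D
  ... | at-v | inj₂ w∈D = inj₂ (w , w∈D , v~w)
  ... | at-w | inj₁ v∈D = inj₂ (v , v∈D , trans (Graph.sym G w v) v~w)
  ... | at-w | inj₂ w∈D = inj₁ w∈D
  ... | at-emb j | _ with dom′ j
  ...   | inj₁ j∈D′             = inj₁ (from (t j) j∈D′)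
  ...   | inj₂ (u′ , u′∈D′ , j~u′) = inj₂ (emb u′ , from (t u′) u′∈D′ , j~u′)

  small-claims : ∀ {s D} → HasDominatingSubset G s D → v ∈ D ⊎ w ∈ D
  small-claims (_ , S⊆D , dom , _) = Sum.map S⊆D S⊆D (dominating-claims dom)

  small-restrict : ∀ {s D D′} → Trace D D′ → w ∉ D →
                   HasDominatingSubset G (suc s) D → HasDominatingSubset G′ s D′
  small-restrict t w∉D (S , S⊆D , dom , size) =
    shrink S , (λ {j} j∈ → to (t j) (S⊆D (from (trace-shrink S j) j∈))) ,
    dominating-restrict (trace-shrink S) w∉S dom , ≤-pred (≤-trans (∣shrink∣ v∈S) size)
    where
    w∉S : w ∉ S
    w∉S = w∉D ∘ S⊆D
    v∈S : v ∈ S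
    v∈S = [ (λ v∈S → v∈S) , (λ w∈S → contradiction w∈S w∉S) ] (dominating-claims dom)

  extend-⊆ : ∀ {S′ D D′ x y} → S′ ⊆ D′ → Trace D D′ →
             (x ≡ inside → v ∈ D) → (y ≡ inside → w ∈ D) → extend S′ x y ⊆ D
  extend-⊆ {S′} {x = x} {y} S′⊆D′ t v-ok w-ok {z} z∈S with position z
  ... | at-v     = v-ok (trans (sym (lookup-extend-v S′ x y)) ([]=⇒lookup z∈S))
  ... | at-w     = w-ok (trans (sym (lookup-extend-w S′ x y)) ([]=⇒lookup z∈S))
  ... | at-emb j = from (t j) (S′⊆D′ (to (trace-extend S′ x y j) z∈S))

  small-lift : ∀ {s D D′} → Trace D D′ → v ∈ D ⊎ w ∈ D →
               HasDominatingSubset G′ s D′ → HasDominatingSubset G (suc s) D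
  small-lift t (inj₁ v∈D) (S′ , S′⊆D′ , dom′ , size) =
    extend S′ inside outside , extend-⊆ S′⊆D′ t (λ _ → v∈D) (λ ()) ,
    dominating-lift (trace-extend S′ inside outside)
                    (inj₁ (lookup⇒[]= v _ (lookup-extend-v S′ inside outside))) dom′ ,
    ≤-trans (≤-reflexive (∣extend∣ S′ inside outside)) (s≤s size)
  small-lift t (inj₂ w∈D) (S′ , S′⊆D′ , dom′ , size) =
    extend S′ outside inside , extend-⊆ S′⊆D′ t (λ ()) (λ _ → w∈D) ,
    dominating-lift (trace-extend S′ outside inside)
                    (inj₂ (lookup⇒[]= w _ (lookup-extend-w S′ outside inside))) dom′ ,
    ≤-trans (≤-reflexive (∣extend∣ S′ outside inside)) (s≤s size)

  private
    module Domination = Transfer dominating-claims dominating-restrict dominating-lift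

  ¬WinWithin-zero : ¬ WinWithin G 0 ⊤ ⊥
  ¬WinWithin-zero = Domination.¬Forces-zero ∘ to WinWithin⇔Forces

  WinWithin-suc⇔ : ∀ {k} → WinWithin G (suc k) ⊤ ⊥ ⇔ WinWithin G′ k ⊤ ⊥
  WinWithin-suc⇔ =
    ⇔.trans WinWithin⇔Forces (⇔.trans Domination.Forces-suc⇔ (⇔.sym WinWithin⇔Forces))

  ¬WinSize-zero : ∀ {U D} → ¬ WinSize G 0 U D
  ¬WinSize-zero (won S _ dom size) = [ empty , empty ] (dominating-claims dom)
    where
    empty : ∀ {x} → x ∉ S
    empty x∈S with ≤-trans (x∈p⇒∣p-x∣<∣p∣ x∈S) size
    ... | ()
  ¬WinSize-zero (round _ _ _ _ _ f _) = ¬WinSize-zero f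

  WinSize-suc⇔ : ∀ {s} → WinSize G (suc s) ⊤ ⊥ ⇔ WinSize G′ s ⊤ ⊥
  WinSize-suc⇔ {s} = ⇔.trans WinSize⇔Forces (⇔.trans (mk⇔ shift unshift) (⇔.sym WinSize⇔Forces))
    where
    open Transfer (small-claims {suc s}) small-restrict small-lift
    shift : (∃ λ k → Forces (HasDominatingSubset G (suc s)) k ⊤ ⊥) →
            ∃ λ k → Forces (HasDominatingSubset G′ s) k ⊤ ⊥
    shift (zero  , f) = ⊥-elim (¬Forces-zero f)
    shift (suc k , f) = k , to Forces-suc⇔ f
    unshift : (∃ λ k → Forces (HasDominatingSubset G′ s) k ⊤ ⊥) →
              ∃ λ k → Forces (HasDominatingSubset G (suc s)) k ⊤ ⊥
    unshift (k , f) = suc k , from Forces-suc⇔ f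

IsMin-unique : ∀ {P : ℕ → Set} {x y} → IsMin P x → IsMin P y → x ≡ y
IsMin-unique {x = just a}  {just b}  (pa , a-min) (pb , b-min) = cong just (≤-antisym (a-min b pb) (b-min a pa))
IsMin-unique {x = just a}  {nothing} (pa , _)     ¬p           = contradiction pa (¬p a)
IsMin-unique {x = nothing} {just b}  ¬p           (pb , _)     = contradiction pb (¬p b)
IsMin-unique {x = nothing} {nothing} _            _            = refl

IsMin-pred : ∀ {P Q : ℕ → Set} → ¬ P 0 → (∀ {k} → P (suc k) ⇔ Q k) →
             ∀ {x} → IsMin P x → ∃ λ y → x ≡ 1 ⊕ y × IsMin Q y
IsMin-pred ¬p0 p⇔q {just zero}    (p0 , _)     = contradiction p0 ¬p0
IsMin-pred ¬p0 p⇔q {just (suc a)} (pa , a-min) =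
  just a , refl , to p⇔q pa , λ j qj → ≤-pred (a-min (suc j) (from p⇔q qj))
IsMin-pred ¬p0 p⇔q {nothing}      ¬p           = nothing , refl , λ j qj → ¬p (suc j) (from p⇔q qj)

⊕-assoc : ∀ a b y → a ⊕ (b ⊕ y) ≡ (a + b) ⊕ y
⊕-assoc a b (just k) = cong just (sym (+-assoc a b k))
⊕-assoc a b nothing  = refl

⊕-identityˡ : ∀ y → 0 ⊕ y ≡ y
⊕-identityˡ (just k) = refl
⊕-identityˡ nothing  = refl

residue-≤ : ∀ {m n} {G : Graph m} {H : Graph n} → Residue G H → n ≤ m
residue-≤ (done _)                    = ≤-refl
residue-≤ (more (step _ _ _ _ _ _) r) = ≤-trans (residue-≤ r) (m≤n+m _ 2)

StepShifts : (∀ {m} → Graph m → ℕ∞ → Set) → Set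
StepShifts I = ∀ {m n} {G : Graph m} {G′ : Graph n} → Step G G′ →
               ∀ {x} → I G x → ∃ λ x′ → x ≡ 1 ⊕ x′ × I G′ x′

residue-shift : (I : ∀ {m} → Graph m → ℕ∞ → Set) →
                (∀ {m} {G : Graph m} {x y} → I G x → I G y → x ≡ y) → StepShifts I →
                ∀ {m n} {G : Graph m} {H : Graph n} → Residue G H →
                ∀ x y → I G x → I H y → x ≡ ⌊ m ∸ n /2⌋ ⊕ y
residue-shift I unique shift {m} (done _) x y Ix Iy = begin
  x                   ≡⟨ unique Ix Iy ⟩
  y                   ≡⟨ ⊕-identityˡ y ⟨
  0 ⊕ y               ≡⟨ cong (λ d → ⌊ d /2⌋ ⊕ y) (n∸n≡0 m) ⟨
  ⌊ m ∸ m /2⌋ ⊕ y     ∎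
  where open ≡-Reasoning
residue-shift I unique shift {n = n} (more st@(step {m} _ _ _ _ _ _) r) x y Ix Iy with shift st Ix
... | x′ , refl , Ix′ = begin
  1 ⊕ x′                       ≡⟨ cong (1 ⊕_) (residue-shift I unique shift r x′ y Ix′ Iy) ⟩
  1 ⊕ (⌊ m ∸ n /2⌋ ⊕ y)         ≡⟨ ⊕-assoc 1 _ y ⟩
  suc ⌊ m ∸ n /2⌋ ⊕ y           ≡⟨ cong (λ d → ⌊ d /2⌋ ⊕ y) (+-∸-assoc 2 (residue-≤ r)) ⟨
  ⌊ suc (suc m) ∸ n /2⌋ ⊕ y     ∎
  where open ≡-Reasoning

γ-shift : StepShifts Isγ
γ-shift (step G v w′ v~w deg-v _) = IsMin-pred ¬WinWithin-zero WinWithin-suc⇔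
  where open LeafRemoval G v w′ v~w deg-v

s-shift : StepShifts IsS
s-shift (step G v w′ v~w deg-v _) = IsMin-pred ¬WinSize-zero WinSize-suc⇔
  where open LeafRemoval G v w′ v~w deg-v

corollary4p2 : ∀ {m n} (G : Graph m) (H : Graph n) → Residue G H →
                 (∀ x y → Isγ G x → Isγ H y → x ≡ ⌊ m ∸ n /2⌋ ⊕ y)
                 × (∀ x y → IsS G x → IsS H y → x ≡ ⌊ m ∸ n /2⌋ ⊕ y)
corollary4p2 G H r = residue-shift Isγ IsMin-unique γ-shift r , residue-shift IsS IsMin-unique s-shift r
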